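{- Let $m\ge1$, $n\ge2$ and $r$ be integers with $0\le r<n$. If $K_{mn+r}$ is $\left(rK_{m+1}\cup(n-r)K_m\right)$-factorable, then $$\bar{R}(n+1;N(m,n,r))=\begin{cases}mn+r+1&\text{if }0\le r\le n-2,\\ mn+n+1&\text{if }r=n-1,\end{cases}$$ where $$N(m,n,r)=\frac{\binom{mn+r}{2}}{r\binom{m+1}{2}+(n-r)\binom{m}{2}}.$$
   Context: For a positive integer $n$, $[n]=\{1,\dots,n\}$. An edge-coloring of $K_n$ with $k$ colors is a map $f:\binom{[n]}{2}\to[k]$; for $i\in[k]$, $\alpha_i(f)$ is the independence number of the graph on $[n]$ whose edges are the pairs of color $i$. For positive integers $m_1,\dots,m_k$, $\bar{R}(m_1,\dots,m_k)$ is the least positive integer $n$ such that for every edge-coloring $f$ of $K_n$ with $k$ colors there is $i\in[k]$ with $\alpha_i(f)\ge m_i$; $\bar{R}(m;k)$ denotes $\bar{R}(m,\dots,m)$ with $k$ arguments. For graphs $G,H$, $G$ is $H$-factorable if the edge set of $G$ is the disjoint union of the edge sets of spanning subgraphs $H_1,\dots,H_k$ of $G$, each isomorphic to $H$. $rK_{m+1}\cup(n-r)K_m$ denotes the disjoint union of $r$ copies of $K_{m+1}$ and $n-r$ copies of $K_m$. -}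

module Defs where

open import Level using (0ℓ)
open import Data.Nat using (ℕ; zero; suc; _+_; _*_; _∸_; _≤_; _<_; _<?_)
open import Data.Nat.Combinatorics using (_C_)
open import Data.Fin using (Fin; toℕ)
open import Data.Product using (Σ; ∃; _×_; _,_)
open import Data.Empty using (⊥)
open import Relation.Nullary using (¬_; yes; no)
open import Relation.Binary.PropositionalEquality using (_≡_; _≢_)
open import Function.Definitions using (Injective)
open import Function.Bundles using (_⤖_; Bijection; _⇔_)

-- A colouring of the unordered
-- pairs is a function f : Fin N → Fin N → Fin k that is symmetric; its
-- values on the diagonal are irrelevant (never used).

record Colouring (N k : ℕ) : Set where
  field
    col : Fin N → Fin N → Fin k
    sym : ∀ x y → col x y ≡ col y x
open Colouring public

IndependentIn : ∀ {N k s} → Colouring N k → Fin k → (Fin s → Fin N) → Set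
IndependentIn f i g = ∀ a b → a ≢ b → col f (g a) (g b) ≢ i

αAtLeast : ∀ {N k} → Colouring N k → Fin k → ℕ → Set
αAtLeast {N} f i s =
  Σ (Fin s → Fin N) λ g → Injective _≡_ _≡_ g × IndependentIn f i g

RbarProp : (k : ℕ) → (Fin k → ℕ) → ℕ → Set
RbarProp k ms n = (f : Colouring n k) → ∃ λ i → αAtLeast f i (ms i)

RbarIs : (k : ℕ) → (Fin k → ℕ) → ℕ → Set
RbarIs k ms n =
  1 ≤ n × RbarProp k ms n × (∀ n′ → 1 ≤ n′ → n′ < n → ¬ RbarProp k ms n′)

RbarDiagIs : (m k n : ℕ) → Set
RbarDiagIs m k n = RbarIs k (λ _ → m) n

Graph : Set → Set₁
Graph V = V → V → Set

_≅_ : ∀ {V W} → Graph V → Graph W → Set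
_≅_ {V} {W} G H =
  Σ (V ⤖ W) λ φ → ∀ u v → G u v ⇔ H (Bijection.to φ u) (Bijection.to φ v)

K : (N : ℕ) → Graph (Fin N)
K N x y = x ≢ y

-- Block sizes of rK_{m+1} ∪ (n−r)K_m: blocks 0,…,r−1 have size m+1,
-- blocks r,…,n−1 have size m.
blockSize : (m r : ℕ) → ∀ {n} → Fin n → ℕ
blockSize m r b with toℕ b <? r
... | yes _ = suc m
... | no  _ = m

CliqueUnionV : (m n r : ℕ) → Set
CliqueUnionV m n r = Σ (Fin n) λ b → Fin (blockSize m r b)

CliqueUnion : (m n r : ℕ) → Graph (CliqueUnionV m n r)
CliqueUnion m n r (b , i) (b′ , i′) = b ≡ b′ × (b , i) ≢ (b′ , i′)

-- K_N is H-factorable: its edge set is the disjoint union of the edge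
-- sets of spanning subgraphs H_1,…,H_t of K_N, each isomorphic to H.
-- (Each G j is a spanning subgraph of K_N: same vertex set Fin N and
-- every edge of G j is an edge of K_N; every edge of K_N lies in exactly
-- one G j.)
Factorable : ∀ {V} → (N : ℕ) → Graph V → Set₁
Factorable {V} N H =
  Σ ℕ λ t → Σ (Fin t → Graph (Fin N)) λ G →
      (∀ j → G j ≅ H)
    × (∀ j x y → G j x y → K N x y)
    × (∀ x y → K N x y → Σ (Fin t) λ j → G j x y × (∀ j′ → G j′ x y → j′ ≡ j))

module Submission where

-- Each factor H_j splits the vertex set into n blocks, and colouring every edge by the
-- factor containing it gives a t-colouring of K_V (V = mn + r) whose colour classes are
-- unions of n cliques, so no colour has an independent set of size n + 1; counting edges
-- gives t = N(m,n,r).  When r = n − 1, a new vertex can join the small block of every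
-- factor, which lifts the bound to V + 1 vertices.  For the upper bound, deleting a
-- vertex of minimum degree d together with its neighbours lowers the degree sum by at
-- least (d + 1)d ≥ 2a(d + 1) − a(a + 1); so a graph on W vertices with α ≤ p has degree
-- sum at least 2aW − p·a(a + 1) for every a.  Summing over the N colours of K_W with
-- a = m, resp. a = m + 1, exceeds the degree sum W(W − 1) of K_W.

open import Defs hiding (sym)
open import Data.Bool.Base using (Bool; true; false; _∧_; not)
open import Data.Bool.Properties using (not-¬; ¬-not) renaming (_≟_ to _≟ᵇ_)
open import Data.Fin.Base as Fin using (Fin; zero; suc; toℕ)
open import Data.Fin.Properties
  using (_≟_; any?; ¬∀⟶∃¬; pigeonhole; inject≤-injective; toℕ-fromℕ<; toℕ-injective; toℕ<n)
  renaming (<⇒≢ to <⇒≢ᶠ)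
open import Data.Nat.Base using (ℕ; zero; suc; _+_; _*_; _∸_; _≤_; _<_; z≤n; s≤s; s≤s⁻¹; z<s; NonZero; >-nonZero; ≢-nonZero)
open import Data.Nat.Combinatorics using (_C_; nC1≡n; nCk+nC[k+1]≡[n+1]C[k+1])
open import Data.Nat.Tactic.RingSolver using (solve-∀)
open import Data.List.Base using (filter; allFin)
open import Data.List.Extrema.Nat using (argmin; argmin-all; f[argmin]≤f[xs])
open import Data.List.Membership.Propositional.Properties using (∈-filter⁺; ∈-filter⁻; ∈-allFin)
import Data.List.Relation.Unary.All as All
open import Data.Nat.Properties hiding (_≟_)
open import Data.Product.Base using (Σ; ∃; _×_; _,_; proj₁; proj₂)
open import Data.Sum.Base using (_⊎_; inj₁; inj₂)
open import Function.Base using (_∘_)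
open import Function.Definitions using (Injective)
open import Function.Bundles using (_⤖_; Bijection; Equivalence)
open import Data.Product.Properties using (,-injectiveʳ-UIP)
open import Axiom.UniquenessOfIdentityProofs using (module Decidable⇒UIP)
open import Relation.Binary.PropositionalEquality
open import Relation.Nullary using (¬_; Dec; yes; no; does; contradiction)
open import Relation.Nullary.Decidable using (dec-true; dec-false)

open import Algebra.Properties.CommutativeSemigroup +-commutativeSemigroup using (xy∙z≈xz∙y; x∙yz≈yx∙z)
open import Algebra.Properties.CommutativeSemigroup *-commutativeSemigroup using (x∙yz≈y∙xz)
open import Algebra.Properties.Semiring.Sum +-*-semiring
  using (sum; sum-syntax; sum-cong-≗; ∑-distrib-+; ∑-comm; *-distribˡ-sum; *-distribʳ-sum; sum-replicate-zero)

sum-const : ∀ n c → ∑[ i < n ] c ≡ n * c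
sum-const zero    c = refl
sum-const (suc n) c = cong (c +_) (sum-const n c)

sum-ones : ∀ n → ∑[ i < n ] 1 ≡ n
sum-ones n = trans (sum-const n 1) (*-identityʳ n)

sum-mono-≤ : ∀ {n} {f g : Fin n → ℕ} → (∀ i → f i ≤ g i) → sum f ≤ sum g
sum-mono-≤ {zero}  f≤g = z≤n
sum-mono-≤ {suc n} f≤g = +-mono-≤ (f≤g zero) (sum-mono-≤ (f≤g ∘ suc))

sum-zero : ∀ {n} {f : Fin n → ℕ} → (∀ i → f i ≡ 0) → sum f ≡ 0
sum-zero {n} f≡0 = trans (sum-cong-≗ f≡0) (sum-replicate-zero n)

𝟙 : Bool → ℕ
𝟙 true  = 1
𝟙 false = 0

count : ∀ {n} → (Fin n → Bool) → ℕ
count P = ∑[ i < _ ] 𝟙 (P i)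

𝟙+𝟙∘not≡1 : ∀ b → 𝟙 b + 𝟙 (not b) ≡ 1
𝟙+𝟙∘not≡1 true  = refl
𝟙+𝟙∘not≡1 false = refl

𝟙-∧ : ∀ a b → 𝟙 (a ∧ b) ≡ 𝟙 a * 𝟙 b
𝟙-∧ true  b = sym (+-identityʳ (𝟙 b))
𝟙-∧ false b = refl

does-sym : ∀ {n} (x y : Fin n) → does (x ≟ y) ≡ does (y ≟ x)
does-sym x y with x ≟ y
... | yes refl = sym (dec-true (x ≟ x) refl)
... | no x≢y   = sym (dec-false (y ≟ x) (x≢y ∘ sym))

does⇒≡ : ∀ {n} {x y : Fin n} → does (x ≟ y) ≡ true → x ≡ y
does⇒≡ {x = x} {y} x≟y with x ≟ y
... | yes x≡y = x≡y

does-injective : ∀ {m n} {e : Fin m → Fin n} → Injective _≡_ _≡_ e →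
                 ∀ a a′ → does (e a ≟ e a′) ≡ does (a ≟ a′)
does-injective {e = e} e-inj a a′ with a ≟ a′
... | yes refl = dec-true (e a ≟ e a) refl
... | no a≢a′  = dec-false (e a ≟ e a′) (a≢a′ ∘ e-inj)

sum-δ : ∀ {n} (x : Fin n) (g : Fin n → ℕ) → ∑[ y < n ] (𝟙 (does (x ≟ y)) * g y) ≡ g x
sum-δ {suc n} zero    g =
  trans (cong₂ _+_ (+-identityʳ (g zero)) (sum-replicate-zero n)) (+-identityʳ (g zero))
sum-δ {suc n} (suc x) g = sum-δ x (g ∘ suc)

count-δ : ∀ {n} (x : Fin n) → count (λ y → does (x ≟ y)) ≡ 1
count-δ {n} x = trans (sum-cong-≗ {n} (λ y → sym (*-identityʳ _))) (sum-δ x (λ _ → 1))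

sum-by-fibres : ∀ {a k} (f : Fin a → Fin k) (h : Fin k → ℕ) →
                ∑[ x < a ] h (f x) ≡ ∑[ b < k ] (h b * count (λ x → does (f x ≟ b)))
sum-by-fibres {a} {k} f h = begin
  ∑[ x < a ] h (f x)                                 ≡⟨ sum-cong-≗ (λ x → sum-δ (f x) h) ⟨
  ∑[ x < a ] ∑[ b < k ] (𝟙 (does (f x ≟ b)) * h b)   ≡⟨ ∑-comm (λ x b → 𝟙 (does (f x ≟ b)) * h b) ⟩
  ∑[ b < k ] ∑[ x < a ] (𝟙 (does (f x ≟ b)) * h b)   ≡⟨ sum-cong-≗ (λ b → pull-out b) ⟩
  ∑[ b < k ] (h b * count (λ x → does (f x ≟ b)))     ∎
  where
  open ≡-Reasoning
  pull-out : ∀ b → ∑[ x < a ] (𝟙 (does (f x ≟ b)) * h b) ≡ h b * count (λ x → does (f x ≟ b))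
  pull-out b = trans (sum-cong-≗ {a} (λ x → *-comm (𝟙 (does (f x ≟ b))) (h b)))
                     (sym (*-distribˡ-sum (h b) (λ x → 𝟙 (does (f x ≟ b)))))

count-image : ∀ {n s} (P : Fin n → Bool) (e : Fin s → Fin n) → Injective _≡_ _≡_ e →
              (∀ a → P (e a) ≡ true) → (∀ y → P y ≡ true → ∃ λ a → e a ≡ y) →
              count P ≡ s
count-image {n} {s} P e e-inj P∘e onto = begin
  count P                                   ≡⟨ sum-cong-≗ preimages ⟩
  ∑[ y < n ] count (λ a → does (y ≟ e a))   ≡⟨ ∑-comm (λ y a → 𝟙 (does (y ≟ e a))) ⟩
  ∑[ a < s ] count (λ y → does (y ≟ e a))   ≡⟨ sum-cong-≗ (λ a → trans (sum-cong-≗ (λ y → cong 𝟙 (does-sym y (e a))))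
                                                                    (count-δ (e a))) ⟩
  ∑[ a < s ] 1                              ≡⟨ sum-ones s ⟩
  s                                         ∎
  where
  open ≡-Reasoning
  preimages : ∀ y → 𝟙 (P y) ≡ count (λ a → does (y ≟ e a))
  preimages y with P y in Py
  ... | true  with onto y Py
  ...   | a₀ , refl = sym (trans (sum-cong-≗ (λ a → cong 𝟙 (does-injective e-inj a₀ a))) (count-δ a₀))
  preimages y | false =
    sym (sum-zero λ a → cong 𝟙 (dec-false (y ≟ e a) λ { refl → not-¬ (P∘e a) Py }))

count≡1⇒∃! : ∀ {n} (P : Fin n → Bool) → count P ≡ 1 →
             Σ (Fin n) λ j → P j ≡ true × (∀ j′ → P j′ ≡ true → j′ ≡ j)
count≡1⇒∃! {n} P count≡1 with any? (λ j → P j ≟ᵇ true)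
... | no  ∄j       = contradiction (trans (sym (sum-zero λ j → cong 𝟙 (¬-not (∄j ∘ (j ,_))))) count≡1) 0≢1+n
... | yes (j , Pj) = j , Pj , unique
  where
  unique : ∀ j′ → P j′ ≡ true → j′ ≡ j
  unique j′ Pj′ with j′ ≟ j
  ... | yes j′≡j = j′≡j
  ... | no  j′≢j = contradiction (subst (2 ≤_) count≡1 two≤count) λ { (s≤s ()) }
    where
    both≤P : ∀ y → 𝟙 (does (j ≟ y)) + 𝟙 (does (j′ ≟ y)) ≤ 𝟙 (P y)
    both≤P y with j ≟ y | j′ ≟ y
    ... | yes refl | yes refl = contradiction refl j′≢j
    ... | yes refl | no _     = ≤-reflexive (cong 𝟙 (sym Pj))
    ... | no _     | yes refl = ≤-reflexive (cong 𝟙 (sym Pj′))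
    ... | no _     | no _     = z≤n
    two≤count : 2 ≤ count P
    two≤count = subst (_≤ count P) (cong₂ _+_ (count-δ j) (count-δ j′))
                  (subst (_≤ count P) (∑-distrib-+ (λ y → 𝟙 (does (j ≟ y))) (λ y → 𝟙 (does (j′ ≟ y))))
                    (sum-mono-≤ both≤P))

empty-or-argmin : ∀ {n} (S : Fin n → Bool) (f : Fin n → ℕ) →
                  (∀ y → S y ≡ false) ⊎ Σ (Fin n) λ v → S v ≡ true × (∀ y → S y ≡ true → f v ≤ f y)
empty-or-argmin {n} S f with any? (λ y → S y ≟ᵇ true)
... | no  ∄y       = inj₁ λ y → ¬-not (∄y ∘ (y ,_))
... | yes (x , Sx) = inj₂ (v , v∈S , v-min)
  where
  S? = λ y → S y ≟ᵇ true
  xs = filter S? (allFin n)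
  v  = argmin f x xs
  v∈S : S v ≡ true
  v∈S = argmin-all f {xs = xs} Sx (All.tabulate λ y∈xs → proj₂ (∈-filter⁻ S? {xs = allFin n} y∈xs))
  v-min : ∀ y → S y ≡ true → f v ≤ f y
  v-min y Sy = All.lookup (f[argmin]≤f[xs] x xs) (∈-filter⁺ S? (∈-allFin y) Sy)

2*nC2+n≡n*n : ∀ n → 2 * (n C 2) + n ≡ n * n
2*nC2+n≡n*n zero    = refl
2*nC2+n≡n*n (suc n) = begin
  2 * (suc n C 2) + suc n          ≡⟨ cong (λ c → 2 * c + suc n) pascal ⟩
  2 * (n + n C 2) + suc n          ≡⟨ regroup n (n C 2) ⟩
  (2 * (n C 2) + n) + (2 * n + 1)  ≡⟨ cong (_+ (2 * n + 1)) (2*nC2+n≡n*n n) ⟩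
  n * n + (2 * n + 1)              ≡⟨ square n ⟩
  suc n * suc n                    ∎
  where
  open ≡-Reasoning
  pascal : suc n C 2 ≡ n + n C 2
  pascal = trans (sym (nCk+nC[k+1]≡[n+1]C[k+1] n 1)) (cong (_+ n C 2) (nC1≡n n))
  regroup : ∀ n c → 2 * (n + c) + suc n ≡ (2 * c + n) + (2 * n + 1)
  regroup = solve-∀
  square : ∀ n → n * n + (2 * n + 1) ≡ suc n * suc n
  square = solve-∀

2*[1+n]C2≡[1+n]*n : ∀ n → 2 * (suc n C 2) ≡ suc n * n
2*[1+n]C2≡[1+n]*n n = +-cancelʳ-≡ (suc n) _ _ (begin
  2 * (suc n C 2) + suc n  ≡⟨ 2*nC2+n≡n*n (suc n) ⟩
  suc n * suc n            ≡⟨ *-suc (suc n) n ⟩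
  suc n + suc n * n        ≡⟨ +-comm (suc n) (suc n * n) ⟩
  suc n * n + suc n        ∎)
  where open ≡-Reasoning

0<nC2 : ∀ {n} → 2 ≤ n → 0 < n C 2
0<nC2 {suc zero}    (s≤s ())
0<nC2 {suc (suc n)} _ =
  subst (0 <_) (nCk+nC[k+1]≡[n+1]C[k+1] (suc n) 1)
        (≤-trans (s≤s z≤n) (subst (_≤ suc n C 1 + suc n C 2) (nC1≡n (suc n)) (m≤m+n (suc n C 1) (suc n C 2))))

-- Independent sets versus degree sums

2a[1+d]≤[1+d]d+a[1+a] : ∀ a d → 2 * a * suc d ≤ suc d * d + a * suc a
2a[1+d]≤[1+d]d+a[1+a] a d with ≤-<-connex a d
... | inj₁ a≤d with m≤n⇒∃[o]m+o≡n a≤d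
...   | e , refl = ≤-trans (m≤m+n _ (e * suc e)) (≤-reflexive (sym (gap a e)))
  where
  gap : ∀ a e → suc (a + e) * (a + e) + a * suc a ≡ 2 * a * suc (a + e) + e * suc e
  gap = solve-∀
2a[1+d]≤[1+d]d+a[1+a] a d | inj₂ d<a with m≤n⇒∃[o]m+o≡n d<a
...   | e , refl = ≤-trans (m≤m+n _ (suc e * e)) (≤-reflexive (sym (gap d e)))
  where
  gap : ∀ d e → suc d * d + suc (d + e) * suc (suc (d + e)) ≡ 2 * suc (d + e) * suc d + suc e * e
  gap = solve-∀

record SimpleGraph (n : ℕ) : Set where
  field
    adjacent        : Fin n → Fin n → Bool
    adjacent-sym    : ∀ x y → adjacent x y ≡ adjacent y x
    adjacent-irrefl : ∀ x → adjacent x x ≡ false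

module Greedy {W : ℕ} (G : SimpleGraph W) where

  open SimpleGraph G

  degreeIn : (Fin W → Bool) → Fin W → ℕ
  degreeIn S x = count (λ y → S y ∧ adjacent x y)

  degreeSum : (Fin W → Bool) → ℕ
  degreeSum S = ∑[ x < W ] (𝟙 (S x) * degreeIn S x)

  IndependentSubset : ℕ → (Fin W → Bool) → Set
  IndependentSubset p S = Σ (Fin p → Fin W) λ g →
    Injective _≡_ _≡_ g × (∀ u → S (g u) ≡ true) × (∀ u u′ → adjacent (g u) (g u′) ≡ false)

  _∖N[_] : (Fin W → Bool) → Fin W → Fin W → Bool
  (S ∖N[ v ]) y = S y ∧ not (adjacent v y) ∧ not (does (v ≟ y))

  module _ (S : Fin W → Bool) (v : Fin W) (v∈S : S v ≡ true) where

    private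
      S′ = S ∖N[ v ]
      N[v] = λ y → S y ∧ not (S′ y)
      d  = degreeIn S v

    ∖N-spec : ∀ y → S′ y ≡ true → S y ≡ true × adjacent v y ≡ false × v ≢ y
    ∖N-spec y S′y with S y | adjacent v y | v ≟ y
    ∖N-spec y ()  | false | _     | _
    ∖N-spec y ()  | true  | true  | _
    ∖N-spec y ()  | true  | false | yes _
    ... | true | false | no v≢y = refl , refl , v≢y

    𝟙-split : ∀ y → 𝟙 (S y) ≡ 𝟙 (S′ y) + 𝟙 (N[v] y)
    𝟙-split y with S y
    ... | false = refl
    ... | true  = sym (𝟙+𝟙∘not≡1 (not (adjacent v y) ∧ not (does (v ≟ y))))

    𝟙-closedNbhd : ∀ y → 𝟙 (N[v] y) ≡ 𝟙 (S y ∧ adjacent v y) + 𝟙 (does (v ≟ y))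
    𝟙-closedNbhd y with v ≟ y
    ... | yes refl rewrite v∈S | adjacent-irrefl v = refl
    ... | no _ with S y | adjacent v y
    ...   | false | _     = refl
    ...   | true  | true  = refl
    ...   | true  | false = refl

    count-closedNbhd : count N[v] ≡ suc d
    count-closedNbhd = begin
      count N[v]
        ≡⟨ sum-cong-≗ 𝟙-closedNbhd ⟩
      ∑[ y < W ] (𝟙 (S y ∧ adjacent v y) + 𝟙 (does (v ≟ y)))
        ≡⟨ ∑-distrib-+ (λ y → 𝟙 (S y ∧ adjacent v y)) (λ y → 𝟙 (does (v ≟ y))) ⟩
      d + count (λ y → does (v ≟ y))
        ≡⟨ cong (d +_) (count-δ v) ⟩
      d + 1
        ≡⟨ +-comm d 1 ⟩
      suc d ∎
      where open ≡-Reasoning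

    count-∖N : count S ≡ count S′ + suc d
    count-∖N = begin
      count S                             ≡⟨ sum-cong-≗ 𝟙-split ⟩
      ∑[ y < W ] (𝟙 (S′ y) + 𝟙 (N[v] y))  ≡⟨ ∑-distrib-+ (𝟙 ∘ S′) (𝟙 ∘ N[v]) ⟩
      count S′ + count N[v]               ≡⟨ cong (count S′ +_) count-closedNbhd ⟩
      count S′ + suc d                    ∎
      where open ≡-Reasoning

    degreeIn-∖N : ∀ x → degreeIn S′ x ≤ degreeIn S x
    degreeIn-∖N x = sum-mono-≤ S′⊆S
      where
      S′⊆S : ∀ y → 𝟙 (S′ y ∧ adjacent x y) ≤ 𝟙 (S y ∧ adjacent x y)
      S′⊆S y with S′ y in S′y
      ... | false = z≤n
      ... | true rewrite proj₁ (∖N-spec y S′y) = ≤-refl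

    degreeSum-∖N : (∀ y → S y ≡ true → d ≤ degreeIn S y) → degreeSum S′ + suc d * d ≤ degreeSum S
    degreeSum-∖N v-min = begin
      degreeSum S′ + suc d * d
        ≡⟨ cong (λ c → degreeSum S′ + c * d) count-closedNbhd ⟨
      degreeSum S′ + count N[v] * d
        ≡⟨ cong (degreeSum S′ +_) (*-distribʳ-sum d (𝟙 ∘ N[v])) ⟩
      degreeSum S′ + ∑[ x < W ] (𝟙 (N[v] x) * d)
        ≤⟨ +-mono-≤ (sum-mono-≤ λ x → *-monoʳ-≤ (𝟙 (S′ x)) (degreeIn-∖N x)) (sum-mono-≤ min-degree) ⟩
      ∑[ x < W ] (𝟙 (S′ x) * degreeIn S x) + ∑[ x < W ] (𝟙 (N[v] x) * degreeIn S x)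
        ≡⟨ ∑-distrib-+ (λ x → 𝟙 (S′ x) * degreeIn S x) (λ x → 𝟙 (N[v] x) * degreeIn S x) ⟨
      ∑[ x < W ] (𝟙 (S′ x) * degreeIn S x + 𝟙 (N[v] x) * degreeIn S x)
        ≡⟨ sum-cong-≗ (λ x → trans (cong (_* degreeIn S x) (𝟙-split x))
                                   (*-distribʳ-+ (degreeIn S x) (𝟙 (S′ x)) (𝟙 (N[v] x)))) ⟨
      degreeSum S                                                                        ∎
      where
      open ≤-Reasoning
      min-degree : ∀ x → 𝟙 (N[v] x) * d ≤ 𝟙 (N[v] x) * degreeIn S x
      min-degree x with S x in Sx
      ... | false = z≤n
      ... | true  = *-monoʳ-≤ (𝟙 (not (not (adjacent v x) ∧ not (does (v ≟ x))))) (v-min x Sx)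

    extend : ∀ {p} → IndependentSubset p S′ → IndependentSubset (suc p) S
    extend {p} (g , g-inj , g∈S′ , g-indep) = g′ , g′-inj , g′∈S , g′-indep
      where
      g′ : Fin (suc p) → Fin W
      g′ zero    = v
      g′ (suc u) = g u
      g∈S : ∀ u → S (g u) ≡ true
      g∈S u = proj₁ (∖N-spec (g u) (g∈S′ u))
      v≁g : ∀ u → adjacent v (g u) ≡ false
      v≁g u = proj₁ (proj₂ (∖N-spec (g u) (g∈S′ u)))
      v≢g : ∀ u → v ≢ g u
      v≢g u = proj₂ (proj₂ (∖N-spec (g u) (g∈S′ u)))
      g′-inj : Injective _≡_ _≡_ g′
      g′-inj {zero}  {zero}   _    = refl
      g′-inj {zero}  {suc u}  v≡gu = contradiction v≡gu (v≢g u)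
      g′-inj {suc u} {zero}   gu≡v = contradiction (sym gu≡v) (v≢g u)
      g′-inj {suc u} {suc u′} gu≡gu′ = cong suc (g-inj gu≡gu′)
      g′∈S : ∀ u → S (g′ u) ≡ true
      g′∈S zero    = v∈S
      g′∈S (suc u) = g∈S u
      g′-indep : ∀ u u′ → adjacent (g′ u) (g′ u′) ≡ false
      g′-indep zero    zero     = adjacent-irrefl v
      g′-indep zero    (suc u′) = v≁g u′
      g′-indep (suc u) zero     = trans (adjacent-sym (g u) v) (v≁g u)
      g′-indep (suc u) (suc u′) = g-indep u u′

  independent-or-dense : ∀ a p S →
    IndependentSubset (suc p) S ⊎ 2 * a * count S ≤ degreeSum S + p * (a * suc a)
  independent-or-dense a p S with empty-or-argmin S (degreeIn S)
  ... | inj₁ S-empty = inj₂ (subst (λ c → 2 * a * c ≤ degreeSum S + p * (a * suc a))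
                                   (sym (sum-zero (cong 𝟙 ∘ S-empty)))
                                   (≤-trans (≤-reflexive (*-zeroʳ (2 * a))) z≤n))
  independent-or-dense a zero S | inj₂ (v , v∈S , _) =
    inj₁ ((λ _ → v) , (λ { {zero} {zero} _ → refl }) , (λ _ → v∈S) , (λ _ _ → adjacent-irrefl v))
  independent-or-dense a (suc p) S | inj₂ (v , v∈S , v-min)
    with independent-or-dense a p (S ∖N[ v ])
  ... | inj₁ I     = inj₁ (extend S v v∈S I)
  ... | inj₂ dense = inj₂ (begin
    2 * a * count S                                   ≡⟨ cong (2 * a *_) (count-∖N S v v∈S) ⟩
    2 * a * (count S′ + suc d)                        ≡⟨ *-distribˡ-+ (2 * a) (count S′) (suc d) ⟩
    2 * a * count S′ + 2 * a * suc d                  ≤⟨ +-mono-≤ dense (2a[1+d]≤[1+d]d+a[1+a] a d) ⟩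
    (degreeSum S′ + p * A) + (suc d * d + A)          ≡⟨ regroup (degreeSum S′) (p * A) (suc d * d) A ⟩
    (degreeSum S′ + suc d * d) + suc p * A            ≤⟨ +-monoˡ-≤ (suc p * A) (degreeSum-∖N S v v∈S v-min) ⟩
    degreeSum S + suc p * A                           ∎)
    where
    open ≤-Reasoning
    S′ = S ∖N[ v ]
    d  = degreeIn S v
    A  = a * suc a
    regroup : ∀ x y z w → (x + y) + (z + w) ≡ (x + z) + (w + y)
    regroup = solve-∀

module ColourClasses {W k : ℕ} (f : Colouring W k) where

  colourClass : Fin k → SimpleGraph W
  colourClass i = record
    { adjacent        = λ x y → not (does (x ≟ y)) ∧ does (col f x y ≟ i)
    ; adjacent-sym    = λ x y → cong₂ (λ a c → not a ∧ does (c ≟ i)) (does-sym x y) (Colouring.sym f x y)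
    ; adjacent-irrefl = λ x → cong (λ a → not a ∧ does (col f x x ≟ i)) (dec-true (x ≟ x) refl)
    }

  degree : Fin k → Fin W → ℕ
  degree i x = count (SimpleGraph.adjacent (colourClass i) x)

  ∑-degree : ∀ x → ∑[ i < k ] degree i x + 1 ≡ W
  ∑-degree x = begin
    ∑[ i < k ] ∑[ y < W ] 𝟙 (not (x≟y y) ∧ c≟i y i) + 1
      ≡⟨ cong (_+ 1) (sum-cong-≗ λ i → sum-cong-≗ λ y → 𝟙-∧ (not (x≟y y)) (c≟i y i)) ⟩
    ∑[ i < k ] ∑[ y < W ] (𝟙 (not (x≟y y)) * 𝟙 (c≟i y i)) + 1
      ≡⟨ cong (_+ 1) (∑-comm (λ i y → 𝟙 (not (x≟y y)) * 𝟙 (c≟i y i))) ⟩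
    ∑[ y < W ] ∑[ i < k ] (𝟙 (not (x≟y y)) * 𝟙 (c≟i y i)) + 1
      ≡⟨ cong₂ _+_ (sum-cong-≗ one-colour) (sym (count-δ x)) ⟩
    ∑[ y < W ] 𝟙 (not (x≟y y)) + count x≟y
      ≡⟨ ∑-distrib-+ (𝟙 ∘ not ∘ x≟y) (𝟙 ∘ x≟y) ⟨
    ∑[ y < W ] (𝟙 (not (x≟y y)) + 𝟙 (x≟y y))
      ≡⟨ sum-cong-≗ (λ y → trans (+-comm (𝟙 (not (x≟y y))) _) (𝟙+𝟙∘not≡1 (x≟y y))) ⟩
    ∑[ y < W ] 1
      ≡⟨ sum-ones W ⟩
    W ∎
    where
    open ≡-Reasoning
    x≟y = λ y → does (x ≟ y)
    c≟i = λ y i → does (col f x y ≟ i)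
    one-colour : ∀ y → ∑[ i < k ] (𝟙 (not (x≟y y)) * 𝟙 (c≟i y i)) ≡ 𝟙 (not (x≟y y))
    one-colour y = begin
      ∑[ i < k ] (𝟙 (not (x≟y y)) * 𝟙 (c≟i y i))  ≡⟨ *-distribˡ-sum (𝟙 (not (x≟y y))) (𝟙 ∘ c≟i y) ⟨
      𝟙 (not (x≟y y)) * count (c≟i y)            ≡⟨ cong (𝟙 (not (x≟y y)) *_) (count-δ (col f x y)) ⟩
      𝟙 (not (x≟y y)) * 1                        ≡⟨ *-identityʳ _ ⟩
      𝟙 (not (x≟y y))                            ∎

  ∑∑-degree : ∑[ i < k ] ∑[ x < W ] degree i x + W ≡ W * W
  ∑∑-degree = begin
    ∑[ i < k ] ∑[ x < W ] degree i x + W             ≡⟨ cong (_+ W) (∑-comm (λ i x → degree i x)) ⟩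
    ∑[ x < W ] ∑[ i < k ] degree i x + W             ≡⟨ cong (∑[ x < W ] ∑[ i < k ] degree i x +_) (sum-ones W) ⟨
    ∑[ x < W ] ∑[ i < k ] degree i x + ∑[ x < W ] 1  ≡⟨ ∑-distrib-+ (λ x → ∑[ i < k ] degree i x) (λ _ → 1) ⟨
    ∑[ x < W ] (∑[ i < k ] degree i x + 1)           ≡⟨ sum-cong-≗ ∑-degree ⟩
    ∑[ x < W ] W                                     ≡⟨ sum-const W W ⟩
    W * W                                            ∎
    where open ≡-Reasoning

  independentSubset⇒αAtLeast : ∀ {p i} →
    Greedy.IndependentSubset (colourClass i) p (λ _ → true) → αAtLeast f i p
  independentSubset⇒αAtLeast {i = i} (g , g-inj , _ , g-indep) = g , g-inj , independent
    where
    independent : IndependentIn f i g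
    independent u u′ u≢u′ colour≡i = contradiction (trans adjacent-true (g-indep u u′)) λ ()
      where
      adjacent-true : true ≡ not (does (g u ≟ g u′)) ∧ does (col f (g u) (g u′) ≟ i)
      adjacent-true = sym (cong₂ (λ a c → not a ∧ c) (dec-false (g u ≟ g u′) (u≢u′ ∘ g-inj))
                                                    (dec-true (col f (g u) (g u′) ≟ i) colour≡i))

  module _ (a p : ℕ) where

    private
      A = a * suc a

      Dense : Fin k → Set
      Dense i = 2 * a * W ≤ ∑[ x < W ] degree i x + p * A

      not-all-dense : W * W + k * (p * A) < k * (2 * a * W) + W → ¬ (∀ i → Dense i)
      not-all-dense excess all-dense = <⇒≱ excess (begin
        k * (2 * a * W) + W                              ≡⟨ cong (_+ W) (sum-const k (2 * a * W)) ⟨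
        ∑[ i < k ] (2 * a * W) + W                       ≤⟨ +-monoˡ-≤ W (sum-mono-≤ all-dense) ⟩
        ∑[ i < k ] (∑[ x < W ] degree i x + p * A) + W
          ≡⟨ cong (_+ W) (∑-distrib-+ (λ i → ∑[ x < W ] degree i x) (λ _ → p * A)) ⟩
        ∑[ i < k ] ∑[ x < W ] degree i x + ∑[ i < k ] (p * A) + W
          ≡⟨ cong (λ c → ∑[ i < k ] ∑[ x < W ] degree i x + c + W) (sum-const k (p * A)) ⟩
        ∑[ i < k ] ∑[ x < W ] degree i x + k * (p * A) + W
          ≡⟨ xy∙z≈xz∙y (∑[ i < k ] ∑[ x < W ] degree i x) (k * (p * A)) W ⟩
        ∑[ i < k ] ∑[ x < W ] degree i x + W + k * (p * A)
          ≡⟨ cong (_+ k * (p * A)) ∑∑-degree ⟩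
        W * W + k * (p * A)                              ∎)
        where open ≤-Reasoning

    αAtLeast-of-turán-excess : W * W + k * (p * A) < k * (2 * a * W) + W → ∃ λ i → αAtLeast f i (suc p)
    αAtLeast-of-turán-excess excess with ¬∀⟶∃¬ k Dense (λ i → _ ≤? _) (not-all-dense excess)
    ... | i , ¬dense with Greedy.independent-or-dense (colourClass i) a p (λ _ → true)
    ...   | inj₁ I     = i , independentSubset⇒αAtLeast I
    ...   | inj₂ dense = contradiction (subst₂ (λ c e → 2 * a * c ≤ e + p * A) (sum-ones W)
                                         (sum-cong-≗ (λ x → *-identityˡ (degree i x))) dense) ¬dense

rbarProp-of-turán-excess : ∀ {W k} a p → W * W + k * (p * (a * suc a)) < k * (2 * a * W) + W →
                           RbarProp k (λ _ → p + 1) W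
rbarProp-of-turán-excess a p excess f with ColourClasses.αAtLeast-of-turán-excess f a p excess
... | i , α = i , subst (αAtLeast f i) (+-comm 1 p) α

record CliquePartitioned {N k : ℕ} (p : ℕ) (f : Colouring N k) : Set where
  field
    part          : Fin k → Fin N → Fin p
    monochromatic : ∀ j x y → x ≢ y → part j x ≡ part j y → col f x y ≡ j

cliquePartitioned⇒¬αAtLeast : ∀ {N k p s} {f : Colouring N k} →
                              CliquePartitioned p f → p < s → ∀ j → ¬ αAtLeast f j s
cliquePartitioned⇒¬αAtLeast partitioned p<s j (g , g-inj , independent)
  with pigeonhole p<s (CliquePartitioned.part partitioned j ∘ g)
... | u , u′ , u<u′ , same-part =
  independent u u′ (<⇒≢ᶠ u<u′)
    (CliquePartitioned.monochromatic partitioned j (g u) (g u′) (<⇒≢ᶠ u<u′ ∘ g-inj) same-part)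

restrict : ∀ {N n k} → n ≤ N → Colouring N k → Colouring n k
restrict n≤N f = record
  { col = λ x y → col f (Fin.inject≤ x n≤N) (Fin.inject≤ y n≤N)
  ; sym = λ x y → Colouring.sym f (Fin.inject≤ x n≤N) (Fin.inject≤ y n≤N)
  }

αAtLeast-restrict : ∀ {N n k j s} (n≤N : n ≤ N) (f : Colouring N k) →
                    αAtLeast (restrict n≤N f) j s → αAtLeast f j s
αAtLeast-restrict n≤N f (g , g-inj , independent) =
  (λ u → Fin.inject≤ (g u) n≤N) , g-inj ∘ inject≤-injective n≤N n≤N _ _ , independent

rbarDiagIs-of-colouring : ∀ {N k s} (f : Colouring N k) → (∀ j → ¬ αAtLeast f j s) →
                          RbarProp k (λ _ → s) (N + 1) → RbarDiagIs s k (N + 1)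
rbarDiagIs-of-colouring {N} f no-α prop = m≤n+m 1 N , prop , minimal
  where
  minimal : ∀ n → 1 ≤ n → n < N + 1 → ¬ RbarProp _ _ n
  minimal n _ n<N+1 prop-n =
    let n≤N = m<1+n⇒m≤n (subst (n <_) (+-comm N 1) n<N+1)
        j , α = prop-n (restrict n≤N f)
    in no-α j (αAtLeast-restrict n≤N f α)

-- The graph rK_{m+1} ∪ (n−r)K_m

cliqueUnionEdges : ℕ → ℕ → ℕ → ℕ
cliqueUnionEdges m n r = r * ((m + 1) C 2) + (n ∸ r) * (m C 2)

cliqueUnionVertices : ∀ m {n r} → r ≤ n → r * suc m + (n ∸ r) * m ≡ m * n + r
cliqueUnionVertices m {n} {r} r≤n with m≤n⇒∃[o]m+o≡n r≤n
... | d , refl = trans (cong (λ e → r * suc m + e * m) (m+n∸m≡n r d)) (count-both r d m)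
  where
  count-both : ∀ r d m → r * suc m + d * m ≡ m * (r + d) + r
  count-both = solve-∀

blockSize-suc : ∀ m r {n} (b : Fin n) → blockSize m (suc r) (suc b) ≡ blockSize m r b
blockSize-suc m r b with toℕ b <? r | suc (toℕ b) <? suc r
... | yes _  | yes _  = refl
... | no _   | no _   = refl
... | yes b<r | no ¬p  = contradiction (s≤s b<r) ¬p
... | no ¬p  | yes p  = contradiction (s≤s⁻¹ p) ¬p

sum-blockSize : ∀ m r {n} (h : ℕ → ℕ) → r ≤ n →
                ∑[ b < n ] h (blockSize m r b) ≡ r * h (suc m) + (n ∸ r) * h m
sum-blockSize m zero    {n}     h _         = sum-const n (h m)
sum-blockSize m (suc r) {suc n} h (s≤s r≤n) = begin
  h (suc m) + ∑[ b < n ] h (blockSize m (suc r) (suc b))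
    ≡⟨ cong (h (suc m) +_) (sum-cong-≗ {n} (λ b → cong h (blockSize-suc m r b))) ⟩
  h (suc m) + ∑[ b < n ] h (blockSize m r b)
    ≡⟨ cong (h (suc m) +_) (sum-blockSize m r h r≤n) ⟩
  h (suc m) + (r * h (suc m) + (n ∸ r) * h m)
    ≡⟨ +-assoc (h (suc m)) (r * h (suc m)) _ ⟨
  suc r * h (suc m) + (n ∸ r) * h m ∎
  where open ≡-Reasoning

blockSize-last : ∀ m {n r} (r<n : r < n) → suc r ≡ n → (b : Fin n) →
                 blockSize m r b + 𝟙 (does (b ≟ Fin.fromℕ< r<n)) ≡ suc m
blockSize-last m {r = r} r<n refl b with toℕ b <? r
... | yes b<r = trans (cong (λ c → suc m + 𝟙 c) (dec-false (b ≟ _) b≢last)) (+-identityʳ (suc m))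
  where
  b≢last : b ≢ Fin.fromℕ< r<n
  b≢last refl = <-irrefl (toℕ-fromℕ< r<n) b<r
... | no ¬b<r = trans (cong (λ c → m + 𝟙 c) (dec-true (b ≟ _) b≡last)) (+-comm m 1)
  where
  b≡last : b ≡ Fin.fromℕ< r<n
  b≡last = toℕ-injective (trans (≤-antisym (s≤s⁻¹ (toℕ<n b)) (≮⇒≥ ¬b<r)) (sym (toℕ-fromℕ< r<n)))

2*cliqueUnionEdges : ∀ m {n r} → r ≤ n → 2 * cliqueUnionEdges (suc m) n r ≡ suc m * (m * n + 2 * r)
2*cliqueUnionEdges m {n} {r} r≤n with m≤n⇒∃[o]m+o≡n r≤n
... | d , refl = begin
  2 * (r * ((suc m + 1) C 2) + (r + d ∸ r) * (suc m C 2))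
    ≡⟨ cong₂ (λ k e → 2 * (r * (k C 2) + e * (suc m C 2))) (+-comm (suc m) 1) (m+n∸m≡n r d) ⟩
  2 * (r * (suc (suc m) C 2) + d * (suc m C 2))
    ≡⟨ distribute r d (suc (suc m) C 2) (suc m C 2) ⟩
  r * (2 * (suc (suc m) C 2)) + d * (2 * (suc m C 2))
    ≡⟨ cong₂ (λ x y → r * x + d * y) (2*[1+n]C2≡[1+n]*n (suc m)) (2*[1+n]C2≡[1+n]*n m) ⟩
  r * (suc (suc m) * suc m) + d * (suc m * m)
    ≡⟨ factor m r d ⟩
  suc m * (m * (r + d) + 2 * r) ∎
  where
  open ≡-Reasoning
  distribute : ∀ r d x y → 2 * (r * x + d * y) ≡ r * (2 * x) + d * (2 * y)
  distribute = solve-∀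
  factor : ∀ m r d → r * (suc (suc m) * suc m) + d * (suc m * m) ≡ suc m * (m * (r + d) + 2 * r)
  factor = solve-∀

double-count-edges : ∀ m {n r k} → r ≤ n → k * cliqueUnionEdges (suc m) n r ≡ (suc m * n + r) C 2 →
  k * (suc m * (m * n + 2 * r)) + (suc m * n + r) ≡ (suc m * n + r) * (suc m * n + r)
double-count-edges m {n} {r} {k} r≤n k*edges≡VC2 = begin
  k * (suc m * (m * n + 2 * r)) + V           ≡⟨ cong (λ e → k * e + V) (2*cliqueUnionEdges m r≤n) ⟨
  k * (2 * cliqueUnionEdges (suc m) n r) + V  ≡⟨ cong (_+ V) (x∙yz≈y∙xz k 2 _) ⟩
  2 * (k * cliqueUnionEdges (suc m) n r) + V  ≡⟨ cong (λ e → 2 * e + V) k*edges≡VC2 ⟩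
  2 * (V C 2) + V                             ≡⟨ 2*nC2+n≡n*n V ⟩
  V * V                                       ∎
  where
  open ≡-Reasoning
  V = suc m * n + r

dense⇒km≤V : ∀ m′ n r k → let m = suc m′ ; V = m * n + r ; W = V + 1 in
  k * (m * (m′ * n + 2 * r)) + V ≡ V * V →
  k * (2 * m * W) + W ≤ W * W + k * (n * (m * suc m)) → k * m ≤ V
dense⇒km≤V m′ n r k double-count dense = *-cancelˡ-≤ 2 (+-cancelˡ-≤ (V * V + c + 1) _ _ (begin
  V * V + c + 1 + 2 * (k * m)            ≡⟨ cong (λ z → z + c + 1 + 2 * (k * m)) double-count ⟨
  k * (m * E) + V + c + 1 + 2 * (k * m)  ≡⟨ expand-lhs m′ n r k ⟩
  k * (2 * m * W) + W                    ≤⟨ dense ⟩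
  W * W + c                              ≡⟨ expand-rhs V c ⟩
  V * V + c + 1 + 2 * V                  ∎))
  where
  open ≤-Reasoning
  m = suc m′
  V = m * n + r
  W = V + 1
  E = m′ * n + 2 * r
  c = k * (n * (m * suc m))
  expand-lhs : ∀ m′ n r k → let m = suc m′ ; V = m * n + r ; W = V + 1 in
    k * (m * (m′ * n + 2 * r)) + V + k * (n * (m * suc m)) + 1 + 2 * (k * m) ≡ k * (2 * m * W) + W
  expand-lhs = solve-∀
  expand-rhs : ∀ V c → (V + 1) * (V + 1) + c ≡ V * V + c + 1 + 2 * V
  expand-rhs = solve-∀

x*E+V≡V*V⇒V≤1+E : ∀ {x V E} .{{_ : NonZero V}} → x * E + V ≡ V * V → x ≤ V → V ≤ suc E
x*E+V≡V*V⇒V≤1+E {x} {V} {E} x*E+V≡V*V x≤V = *-cancelˡ-≤ V (begin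
  V * V      ≡⟨ x*E+V≡V*V ⟨
  x * E + V  ≤⟨ +-monoˡ-≤ V (*-monoˡ-≤ E x≤V) ⟩
  V * E + V  ≡⟨ trans (*-suc V E) (+-comm V (V * E)) ⟨
  V * suc E  ∎)
  where open ≤-Reasoning

turán-excess-r+2≤n : ∀ {m n r k} → 1 ≤ m → r + 2 ≤ n → k * cliqueUnionEdges m n r ≡ (m * n + r) C 2 →
  let W = m * n + r + 1 in W * W + k * (n * (m * suc m)) < k * (2 * m * W) + W
turán-excess-r+2≤n {suc m′} {n} {r} {k} _ r+2≤n k*edges≡VC2 = ≰⇒> λ dense →
  let km≤V  = dense⇒km≤V m′ n r k double-count dense
      V≤1+E = x*E+V≡V*V⇒V≤1+E {{>-nonZero 0<V}} (trans (cong (_+ V) (*-assoc k m E)) double-count) km≤V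
      n≤1+r = +-cancelˡ-≤ (m′ * n + r) _ _ (subst₂ _≤_ (split-V m′ n r) (split-1+E m′ n r) V≤1+E)
  in <-irrefl refl (≤-trans (subst (_≤ n) (+-comm r 2) r+2≤n) n≤1+r)
  where
  m = suc m′
  V = m * n + r
  E = m′ * n + 2 * r
  double-count : k * (m * E) + V ≡ V * V
  double-count = double-count-edges m′ {k = k} (≤-trans (m≤m+n r 2) r+2≤n) k*edges≡VC2
  0<V : 0 < V
  0<V = ≤-trans (s≤s z≤n) (≤-trans (m≤n+m 2 r) (≤-trans r+2≤n (≤-trans (m≤m+n n (m′ * n)) (m≤m+n (m * n) r))))
  split-V : ∀ m′ n r → suc m′ * n + r ≡ (m′ * n + r) + n
  split-V = solve-∀
  split-1+E : ∀ m′ n r → suc (m′ * n + 2 * r) ≡ (m′ * n + r) + suc r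
  split-1+E = solve-∀

k*m≡V : ∀ {m n r k} → 1 ≤ m → 1 ≤ r → suc r ≡ n → k * cliqueUnionEdges m n r ≡ (m * n + r) C 2 →
        k * m ≡ m * n + r
k*m≡V {suc m′} {r = suc r′} {k} _ _ refl k*edges≡VC2 =
  *-cancelʳ-≡ (k * m) V E {{>-nonZero 0<E}} (+-cancelʳ-≡ V _ _ (begin
    k * m * E + V    ≡⟨ cong (_+ V) (*-assoc k m E) ⟩
    k * (m * E) + V  ≡⟨ double-count-edges m′ {k = k} (n≤1+n r) k*edges≡VC2 ⟩
    V * V            ≡⟨ V≡1+E m′ r′ ⟩
    V * E + V        ∎))
  where
  open ≡-Reasoning
  m = suc m′
  r = suc r′
  n = suc r
  V = m * n + r
  E = m′ * n + 2 * r
  0<E : 0 < E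
  0<E = ≤-trans (s≤s z≤n) (m≤n+m (2 * r) (m′ * n))
  V≡1+E : ∀ m′ r′ → let m = suc m′ ; r = suc r′ ; n = suc r ; V = m * n + r in
          V * V ≡ V * (m′ * n + 2 * r) + V
  V≡1+E = solve-∀

turán-excess-r+1≡n : ∀ {m n r k} → 1 ≤ m → 1 ≤ r → suc r ≡ n → k * m ≡ m * n + r →
  let W = m * n + n + 1 in W * W + k * (n * (suc m * suc (suc m))) < k * (2 * suc m * W) + W
turán-excess-r+1≡n {suc m′} {r = suc r′} {k} _ _ refl k*m≡V = *-cancelˡ-< m _ _ (begin-strict
  m * (W * W + k * Y)         ≡⟨ distribute m k (W * W) Y ⟩
  m * (W * W) + k * m * Y     ≡⟨ cong (λ z → m * (W * W) + z * Y) k*m≡V ⟩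
  m * (W * W) + V * Y         <⟨ m<m+n (m * (W * W) + V * Y) z<s ⟩
  m * (W * W) + V * Y + 2 * a * r ≡⟨ surplus m′ r′ ⟩
  V * X + m * W               ≡⟨ cong (λ z → z * X + m * W) k*m≡V ⟨
  k * m * X + m * W           ≡⟨ distribute′ m k W X ⟨
  m * (k * X + W)             ∎)
  where
  open ≤-Reasoning
  m = suc m′
  r = suc r′
  n = suc r
  a = suc m
  V = m * n + r
  W = m * n + n + 1
  X = 2 * a * W
  Y = n * (a * suc a)
  distribute : ∀ m k x y → m * (x + k * y) ≡ m * x + k * m * y
  distribute = solve-∀
  distribute′ : ∀ m k x y → m * (k * y + x) ≡ k * m * y + m * x
  distribute′ = solve-∀
  surplus : ∀ m′ r′ → let m = suc m′ ; r = suc r′ ; n = suc r ; a = suc m ; V = m * n + r ; W = m * n + n + 1 in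
    m * (W * W) + V * (n * (a * suc a)) + 2 * a * r ≡ V * (2 * a * W) + m * W
  surplus = solve-∀

-- The colouring of a factorisation

module Factorization {m n r : ℕ} (factorisation : Factorable (m * n + r) (CliqueUnion m n r))
                     (2≤V : 2 ≤ m * n + r) where

  V : ℕ
  V = m * n + r

  t : ℕ
  t = proj₁ factorisation

  private
    H : Fin t → Graph (Fin V)
    H = proj₁ (proj₂ factorisation)

    H≅ : ∀ j → H j ≅ CliqueUnion m n r
    H≅ = proj₁ (proj₂ (proj₂ factorisation))

    unique-factor : ∀ x y → x ≢ y → Σ (Fin t) λ j → H j x y × (∀ j′ → H j′ x y → j′ ≡ j)
    unique-factor = proj₂ (proj₂ (proj₂ (proj₂ factorisation)))

    φ : Fin t → Fin V ⤖ CliqueUnionV m n r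
    φ j = proj₁ (H≅ j)

  block : Fin t → Fin V → Fin n
  block j x = proj₁ (Bijection.to (φ j) x)

  private
    H⇒sameBlock : ∀ j {x y} → H j x y → block j x ≡ block j y
    H⇒sameBlock j {x} {y} h = proj₁ (Equivalence.to (proj₂ (H≅ j) x y) h)

    sameBlock⇒H : ∀ j {x y} → x ≢ y → block j x ≡ block j y → H j x y
    sameBlock⇒H j {x} {y} x≢y same =
      Equivalence.from (proj₂ (H≅ j) x y) (same , x≢y ∘ Bijection.injective (φ j))

    someFactor : Fin t
    someFactor = proj₁ (unique-factor (Fin.inject≤ zero 2≤V) (Fin.inject≤ (suc zero) 2≤V)
                                      ((λ ()) ∘ inject≤-injective 2≤V 2≤V zero (suc zero)))

  colour : Fin V → Fin V → Fin t
  colour x y with x ≟ y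
  ... | yes _   = someFactor
  ... | no  x≢y = proj₁ (unique-factor x y x≢y)

  private
    H-colour : ∀ {x y} → x ≢ y → H (colour x y) x y
    H-colour {x} {y} x≢y with x ≟ y
    ... | yes x≡y  = contradiction x≡y x≢y
    ... | no  x≢y′ = proj₁ (proj₂ (unique-factor x y x≢y′))

    colour-unique : ∀ {x y} → x ≢ y → ∀ j → H j x y → j ≡ colour x y
    colour-unique {x} {y} x≢y j h with x ≟ y
    ... | yes x≡y  = contradiction x≡y x≢y
    ... | no  x≢y′ = proj₂ (proj₂ (unique-factor x y x≢y′)) j h

  sameBlock⇒colour≡ : ∀ j {x y} → x ≢ y → block j x ≡ block j y → colour x y ≡ j
  sameBlock⇒colour≡ j x≢y same = sym (colour-unique x≢y j (sameBlock⇒H j x≢y same))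

  colour≡⇒sameBlock : ∀ j {x y} → x ≢ y → colour x y ≡ j → block j x ≡ block j y
  colour≡⇒sameBlock _ x≢y refl = H⇒sameBlock _ (H-colour x≢y)

  colour-sym : ∀ x y → colour x y ≡ colour y x
  colour-sym x y = symmetric (x ≟ y)
    where
    symmetric : Dec (x ≡ y) → colour x y ≡ colour y x
    symmetric (yes refl) = refl
    symmetric (no x≢y)   = sym (sameBlock⇒colour≡ (colour x y) (x≢y ∘ sym)
                                  (sym (colour≡⇒sameBlock (colour x y) x≢y refl)))

  colouring : Colouring V t
  colouring = record { col = colour ; sym = colour-sym }

  cliquePartitioned : CliquePartitioned n colouring
  cliquePartitioned = record { part = block ; monochromatic = λ j x y → sameBlock⇒colour≡ j }

  blockCount : ∀ j b → count (λ y → does (block j y ≟ b)) ≡ blockSize m r b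
  blockCount j b = count-image (λ y → does (block j y ≟ b)) member member-injective
                               (λ i → dec-true (block j (member i) ≟ b) (cong proj₁ (to-member i)))
                               onto
    where
    member : Fin (blockSize m r b) → Fin V
    member i = proj₁ (Bijection.strictlySurjective (φ j) (b , i))
    to-member : ∀ i → Bijection.to (φ j) (member i) ≡ (b , i)
    to-member i = proj₂ (Bijection.strictlySurjective (φ j) (b , i))
    member-injective : Injective _≡_ _≡_ member
    member-injective {i} {i′} eq = ,-injectiveʳ-UIP (Decidable⇒UIP.≡-irrelevant _≟_)
      (trans (sym (to-member i)) (trans (cong (Bijection.to (φ j)) eq) (to-member i′)))
    index : ∀ (z : CliqueUnionV m n r) → proj₁ z ≡ b → Σ (Fin (blockSize m r b)) λ i → (b , i) ≡ z
    index (_ , i) refl = i , refl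
    onto : ∀ y → does (block j y ≟ b) ≡ true → ∃ λ i → member i ≡ y
    onto y in-block =
      let i , bi≡φy = index (Bijection.to (φ j) y) (does⇒≡ in-block)
      in i , Bijection.injective (φ j) (trans (to-member i) bi≡φy)

  open ColourClasses colouring using (degree; ∑-degree; ∑∑-degree)

  degree+1≡blockSize : ∀ j x → degree j x + 1 ≡ blockSize m r (block j x)
  degree+1≡blockSize j x = begin
    degree j x + 1                                           ≡⟨ cong (degree j x +_) (count-δ x) ⟨
    degree j x + count (λ y → does (x ≟ y))                  ≡⟨ ∑-distrib-+ (λ y → 𝟙 (adjacent y)) (λ y → 𝟙 (does (x ≟ y))) ⟨
    ∑[ y < V ] (𝟙 (adjacent y) + 𝟙 (does (x ≟ y)))           ≡⟨ sum-cong-≗ closed-neighbourhood ⟩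
    count (λ y → does (block j y ≟ block j x))               ≡⟨ blockCount j (block j x) ⟩
    blockSize m r (block j x)                                ∎
    where
    open ≡-Reasoning
    adjacent = λ y → not (does (x ≟ y)) ∧ does (colour x y ≟ j)
    closed-neighbourhood : ∀ y → 𝟙 (adjacent y) + 𝟙 (does (x ≟ y)) ≡ 𝟙 (does (block j y ≟ block j x))
    closed-neighbourhood y = by-cases (x ≟ y)
      where
      by-cases : Dec (x ≡ y) → 𝟙 (adjacent y) + 𝟙 (does (x ≟ y)) ≡ 𝟙 (does (block j y ≟ block j x))
      by-cases (yes refl) =
        trans (cong (λ d → 𝟙 (not d ∧ does (colour x x ≟ j)) + 𝟙 d) (dec-true (x ≟ x) refl))
              (sym (cong 𝟙 (dec-true (block j x ≟ block j x) refl)))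
      by-cases (no x≢y) =
        trans (cong (λ d → 𝟙 (not d ∧ does (colour x y ≟ j)) + 𝟙 d) (dec-false (x ≟ y) x≢y))
              (trans (+-identityʳ _) (cong 𝟙 same-answer))
        where
        same-answer : does (colour x y ≟ j) ≡ does (block j y ≟ block j x)
        same-answer with colour x y ≟ j | block j y ≟ block j x
        ... | yes _   | yes _        = refl
        ... | no _    | no _         = refl
        ... | yes c≡j | no different = contradiction (sym (colour≡⇒sameBlock j x≢y c≡j)) different
        ... | no c≢j  | yes same     = contradiction (sameBlock⇒colour≡ j x≢y (sym same)) c≢j

  ∑-degree≡2*edges : r ≤ n → ∀ j → ∑[ x < V ] degree j x ≡ 2 * cliqueUnionEdges m n r
  ∑-degree≡2*edges r≤n j = +-cancelʳ-≡ V _ _ (begin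
    ∑[ x < V ] degree j x + V
      ≡⟨ cong (∑[ x < V ] degree j x +_) (sum-ones V) ⟨
    ∑[ x < V ] degree j x + ∑[ x < V ] 1
      ≡⟨ ∑-distrib-+ (degree j) (λ _ → 1) ⟨
    ∑[ x < V ] (degree j x + 1)
      ≡⟨ sum-cong-≗ (degree+1≡blockSize j) ⟩
    ∑[ x < V ] size (block j x)
      ≡⟨ sum-by-fibres (block j) size ⟩
    ∑[ b < n ] (size b * count (λ x → does (block j x ≟ b)))
      ≡⟨ sum-cong-≗ (λ b → cong (size b *_) (blockCount j b)) ⟩
    ∑[ b < n ] (size b * size b)
      ≡⟨ sum-cong-≗ (λ b → 2*nC2+n≡n*n (size b)) ⟨
    ∑[ b < n ] (2 * (size b C 2) + size b)
      ≡⟨ ∑-distrib-+ (λ b → 2 * (size b C 2)) size ⟩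
    ∑[ b < n ] (2 * (size b C 2)) + ∑[ b < n ] size b
      ≡⟨ cong₂ _+_ (*-distribˡ-sum 2 (λ b → size b C 2)) (sym (sum-blockSize m r (λ s → s) r≤n)) ⟨
    2 * ∑[ b < n ] (size b C 2) + (r * suc m + (n ∸ r) * m)
      ≡⟨ cong₂ (λ e v → 2 * e + v) (trans (sum-blockSize m r (_C 2) r≤n) suc≡+1)
                                   (cliqueUnionVertices m r≤n) ⟩
    2 * cliqueUnionEdges m n r + V ∎)
    where
    open ≡-Reasoning
    size : Fin n → ℕ
    size = blockSize m r
    suc≡+1 : r * (suc m C 2) + (n ∸ r) * (m C 2) ≡ cliqueUnionEdges m n r
    suc≡+1 = cong (λ k → r * (k C 2) + (n ∸ r) * (m C 2)) (+-comm 1 m)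

  t*edges≡VC2 : r ≤ n → t * cliqueUnionEdges m n r ≡ V C 2
  t*edges≡VC2 r≤n = *-cancelˡ-≡ _ _ 2 (+-cancelʳ-≡ V _ _ (begin
    2 * (t * E) + V                      ≡⟨ cong (_+ V) (x∙yz≈y∙xz 2 t E) ⟩
    t * (2 * E) + V                      ≡⟨ cong (_+ V) (sum-const t (2 * E)) ⟨
    ∑[ j < t ] (2 * E) + V               ≡⟨ cong (_+ V) (sum-cong-≗ (∑-degree≡2*edges r≤n)) ⟨
    ∑[ j < t ] ∑[ x < V ] degree j x + V ≡⟨ ∑∑-degree ⟩
    V * V                                ≡⟨ 2*nC2+n≡n*n V ⟨
    2 * (V C 2) + V                      ∎))
    where
    open ≡-Reasoning
    E = cliqueUnionEdges m n r

  -- For r = n − 1 the only small block of a factor is the last one, of size m, and since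
  -- t m = V every vertex lies in exactly one of them.
  module LastBlockExtension (r<n : r < n) (1+r≡n : suc r ≡ n) (t*m≡V : t * m ≡ V) where

    lastBlock : Fin n
    lastBlock = Fin.fromℕ< r<n

    count-lastBlock : ∀ u → count (λ j → does (block j u ≟ lastBlock)) ≡ 1
    count-lastBlock u = +-cancelˡ-≡ (D + t) _ _ (begin
      D + t + L                                        ≡⟨ cong (_+ L) ∑[degree+1] ⟨
      ∑[ j < t ] (degree j u + 1) + L                  ≡⟨ ∑-distrib-+ (λ j → degree j u + 1) (λ j → 𝟙 (inLast j)) ⟨
      ∑[ j < t ] (degree j u + 1 + 𝟙 (inLast j))       ≡⟨ sum-cong-≗ (λ j → trans (cong (_+ 𝟙 (inLast j)) (degree+1≡blockSize j u))
                                                                              (blockSize-last m r<n 1+r≡n (block j u))) ⟩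
      ∑[ j < t ] suc m                                 ≡⟨ sum-const t (suc m) ⟩
      t * suc m                                        ≡⟨ *-suc t m ⟩
      t + t * m                                        ≡⟨ cong (t +_) (trans t*m≡V (sym (∑-degree u))) ⟩
      t + (D + 1)                                      ≡⟨ x∙yz≈yx∙z t D 1 ⟩
      D + t + 1                                        ∎)
      where
      open ≡-Reasoning
      D = ∑[ j < t ] degree j u
      inLast = λ j → does (block j u ≟ lastBlock)
      L = count inLast
      ∑[degree+1] : ∑[ j < t ] (degree j u + 1) ≡ D + t
      ∑[degree+1] = trans (∑-distrib-+ (λ j → degree j u) (λ _ → 1)) (cong (D +_) (sum-ones t))

    lastBlockFactor : Fin V → Fin t
    lastBlockFactor u = proj₁ (count≡1⇒∃! _ (count-lastBlock u))

    lastBlockFactor-unique : ∀ u j → block j u ≡ lastBlock → lastBlockFactor u ≡ j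
    lastBlockFactor-unique u j in-last =
      sym (proj₂ (proj₂ (count≡1⇒∃! _ (count-lastBlock u))) j (dec-true (block j u ≟ lastBlock) in-last))

    extendedColour : Fin (suc V) → Fin (suc V) → Fin t
    extendedColour zero    zero    = someFactor
    extendedColour zero    (suc u) = lastBlockFactor u
    extendedColour (suc u) zero    = lastBlockFactor u
    extendedColour (suc x) (suc y) = colour x y

    extendedColour-sym : ∀ x y → extendedColour x y ≡ extendedColour y x
    extendedColour-sym zero    zero    = refl
    extendedColour-sym zero    (suc u) = refl
    extendedColour-sym (suc u) zero    = refl
    extendedColour-sym (suc x) (suc y) = colour-sym x y

    extendedColouring : Colouring (suc V) t
    extendedColouring = record { col = extendedColour ; sym = extendedColour-sym }

    extendedBlock : Fin t → Fin (suc V) → Fin n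
    extendedBlock j zero    = lastBlock
    extendedBlock j (suc x) = block j x

    extendedPartitioned : CliquePartitioned n extendedColouring
    extendedPartitioned = record { part = extendedBlock ; monochromatic = monochromatic }
      where
      monochromatic : ∀ j x y → x ≢ y → extendedBlock j x ≡ extendedBlock j y → extendedColour x y ≡ j
      monochromatic j zero    zero    x≢y _      = contradiction refl x≢y
      monochromatic j zero    (suc u) _   last≡b = lastBlockFactor-unique u j (sym last≡b)
      monochromatic j (suc u) zero    _   b≡last = lastBlockFactor-unique u j b≡last
      monochromatic j (suc x) (suc y) x≢y same   = sameBlock⇒colour≡ j (x≢y ∘ cong suc) same

  t≡N : ∀ {N} → r ≤ n → N * cliqueUnionEdges m n r ≡ V C 2 → t ≡ N
  t≡N {N} r≤n N*edges≡VC2 = *-cancelʳ-≡ t N _ {{≢-nonZero edges≢0}} (trans (t*edges≡VC2 r≤n) (sym N*edges≡VC2))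
    where
    edges≢0 : cliqueUnionEdges m n r ≢ 0
    edges≢0 edges≡0 = <⇒≢ (0<nC2 2≤V)
      (sym (trans (sym (t*edges≡VC2 r≤n)) (trans (cong (t *_) edges≡0) (*-zeroʳ t))))

  rbar-r+2≤n : 1 ≤ m → r + 2 ≤ n → RbarDiagIs (n + 1) t (V + 1)
  rbar-r+2≤n 1≤m r+2≤n =
    rbarDiagIs-of-colouring colouring
      (cliquePartitioned⇒¬αAtLeast cliquePartitioned (m<m+n n {1} z<s))
      (rbarProp-of-turán-excess m n (turán-excess-r+2≤n {k = t} 1≤m r+2≤n (t*edges≡VC2 r≤n)))
    where r≤n = ≤-trans (m≤m+n r 2) r+2≤n

  rbar-r+1≡n : 1 ≤ m → 1 ≤ r → suc r ≡ n → RbarDiagIs (n + 1) t (m * n + n + 1)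
  rbar-r+1≡n 1≤m 1≤r 1+r≡n = subst (RbarDiagIs (n + 1) t) V+2≡W
    (rbarDiagIs-of-colouring extendedColouring
      (cliquePartitioned⇒¬αAtLeast extendedPartitioned (m<m+n n {1} z<s))
      (subst (RbarProp t (λ _ → n + 1)) (sym V+2≡W)
        (rbarProp-of-turán-excess (suc m) n (turán-excess-r+1≡n {k = t} 1≤m 1≤r 1+r≡n t*m≡V))))
    where
    t*m≡V : t * m ≡ V
    t*m≡V = k*m≡V {k = t} 1≤m 1≤r 1+r≡n (t*edges≡VC2 (subst (r ≤_) 1+r≡n (n≤1+n r)))
    open LastBlockExtension (subst (r <_) 1+r≡n ≤-refl) 1+r≡n t*m≡V
    V+2≡W : suc V + 1 ≡ m * n + n + 1
    V+2≡W = cong (_+ 1) (trans (sym (+-suc (m * n) r)) (cong (m * n +_) 1+r≡n))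

corollary4p5 : (m n r : ℕ) → 1 ≤ m → 2 ≤ n → r < n →
    Factorable (m * n + r) (CliqueUnion m n r) →
    (Nmnr : ℕ) →
    Nmnr * (r * ((m + 1) C 2) + (n ∸ r) * (m C 2)) ≡ (m * n + r) C 2 →
    (r ≤ n ∸ 2 → RbarDiagIs (n + 1) Nmnr (m * n + r + 1))
    × (r ≡ n ∸ 1 → RbarDiagIs (n + 1) Nmnr (m * n + n + 1))
corollary4p5 m n r 1≤m 2≤n r<n factorisation N N*edges≡VC2 =
  subst (λ k → (r ≤ n ∸ 2 → RbarDiagIs (n + 1) k (m * n + r + 1))
             × (r ≡ n ∸ 1 → RbarDiagIs (n + 1) k (m * n + n + 1)))
        (t≡N (<⇒≤ r<n) N*edges≡VC2)
        ( (λ r≤n-2 → rbar-r+2≤n 1≤m (m≤o∸n⇒m+n≤o r 2≤n r≤n-2))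
        , (λ r≡n-1 → rbar-r+1≡n 1≤m (subst (1 ≤_) (sym r≡n-1) (m+n≤o⇒m≤o∸n 1 2≤n))
                                    (trans (cong suc r≡n-1) (m+[n∸m]≡n (≤-trans (s≤s z≤n) 2≤n)))) )
  where
  open Factorization {m} {n} {r} factorisation
         (≤-trans 2≤n (≤-trans (m≤n*m n m {{>-nonZero 1≤m}}) (m≤m+n (m * n) r)))
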